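{- Let $X$ be a finite set with $|X|\ge2$, and suppose a partition $\mathcal{P}$ of $X$ and a rooted phylogenetic tree $T$ on $X$ with hierarchy $\mathcal{H}$ are compatible. Then there exists a minimum-sized set $H^*\subseteq E(T)$ with $\mathcal{P}=\mathcal{F}(T,H^*)$ and $|H^*|=|\mathcal{P}|-1$. Moreover, for $$H=\{\{\mathrm{parent}(\mathrm{lca}_T(A)),\mathrm{lca}_T(A)\} : A\in\mathcal{P},\ \mathrm{lca}_T(A)\neq\rho_T\},$$ we have $|H|\in\{|\mathcal{P}|-1,|\mathcal{P}|\}$, and $|H|=|\mathcal{P}|-1$ if and only if there is some $A\in\mathcal{P}$ with $A_{\mathcal{H}}=X$.
   Context: A rooted phylogenetic tree $T$ on $X$ is a rooted tree with root $\rho_T$ and leaf set $X$ in which every non-leaf vertex has at least two children; $\mathrm{parent}(v)$ is the parent of $v\neq\rho_T$, and $\mathrm{lca}_T(A)$ the last common ancestor of nonempty $A\subseteq X$. $\mathcal{H}=\{L(T(v)):v\in V(T)\}$ is the hierarchy of $T$, and for nonempty $A\subseteq X$, $A_{\mathcal{H}}$ is the inclusion-minimal member of $\mathcal{H}$ containing $A$ (equivalently $A_{\mathcal{H}}=L(T(\mathrm{lca}_T(A)))$). For $H\subseteq E(T)$, $\mathcal{F}(T,H)$ is the partition of $X$ into leaf sets of the connected components of $T-H$; $\mathcal{P}$ and $T$ are compatible if $\mathcal{P}=\mathcal{F}(T,H)$ for some $H\subseteq E(T)$. -}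

module Defs where

open import Data.Nat using (ℕ; zero; suc)
open import Data.Fin using (Fin)
open import Data.Fin.Subset using (Subset; _∈_; _∉_; ∣_∣)
open import Data.Product using (Σ; ∃; ∃-syntax; _×_; _,_)
open import Relation.Binary.PropositionalEquality using (_≡_; _≢_)
open import Relation.Nullary using (¬_)

iter : {A : Set} → (A → A) → ℕ → A → A
iter f zero    a = a
iter f (suc k) a = f (iter f k a)

-- A rooted tree on the vertex set Fin n, given by a root and a parent map.
-- par root ≡ root is a convention (the root has no parent); every vertex
-- reaches the root by iterating the parent map, so the graph with edges
-- {v , par v} (v ≢ root) is a tree rooted at root.
record RootedTree (n : ℕ) : Set where
  field
    root     : Fin n
    par      : Fin n → Fin n
    par-root : par root ≡ root
    reach    : ∀ v → ∃[ k ] iter par k v ≡ root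

module _ {n : ℕ} (T : RootedTree n) where
  open RootedTree T

  Child : Fin n → Fin n → Set
  Child u v = u ≢ root × par u ≡ v

  -- leaves: vertices without children; the leaf set is X
  IsLeaf : Fin n → Set
  IsLeaf v = ∀ u → ¬ Child u v

  Phylogenetic : Set
  Phylogenetic = ∀ v → ¬ IsLeaf v → ∃[ u ] ∃[ w ] (Child u v × Child w v × u ≢ w)

  AtLeastTwoLeaves : Set
  AtLeastTwoLeaves = ∃[ x ] ∃[ y ] (IsLeaf x × IsLeaf y × x ≢ y)

  Desc : Fin n → Fin n → Set
  Desc u v = ∃[ k ] iter par k u ≡ v

  -- Edge sets: the edge {par v , v} (v ≢ root) is identified with its child
  -- endpoint v, so H ⊆ E(T) is a subset of Fin n not containing the root.
  EdgeSet : Subset n → Set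
  EdgeSet H = root ∉ H

  data Conn (H : Subset n) : Fin n → Fin n → Set where
    here : ∀ {u} → Conn H u u
    up   : ∀ {v w} → v ≢ root → v ∉ H → Conn H (par v) w → Conn H v w
    down : ∀ {v w} → v ≢ root → v ∉ H → Conn H v w → Conn H (par v) w

  -- A partition P of X with m blocks, encoded by a block-labelling of the
  -- leaves that hits every label on some leaf: the blocks are
  -- A_i = { x ∈ X | block x ≡ i }, all nonempty, so |P| = m.
  IsPartition : (m : ℕ) → (Fin n → Fin m) → Set
  IsPartition m block = ∀ i → ∃[ x ] (IsLeaf x × block x ≡ i)

  InBlock : {m : ℕ} → (Fin n → Fin m) → Fin m → Fin n → Set
  InBlock block i x = IsLeaf x × block x ≡ i

  -- P = F(T , H): two leaves are in the same block iff they lie in the same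
  -- connected component of T - H.
  PartEqF : {m : ℕ} → (Fin n → Fin m) → Subset n → Set
  PartEqF block H = ∀ x y → IsLeaf x → IsLeaf y →
    (block x ≡ block y → Conn H x y) × (Conn H x y → block x ≡ block y)

  Compatible : {m : ℕ} → (Fin n → Fin m) → Set
  Compatible block = ∃[ H ] (EdgeSet H × PartEqF block H)

  IsLCA : {m : ℕ} → (Fin n → Fin m) → Fin m → Fin n → Set
  IsLCA block i w =
    (∀ x → InBlock block i x → Desc x w) ×
    (∀ w' → (∀ x → InBlock block i x → Desc x w') → Desc w w')

  -- (A_i)_H = X, i.e. L(T(lca_T(A_i))) = X: every leaf descends from w
  ClusterIsX : Fin n → Set
  ClusterIsX w = ∀ x → IsLeaf x → Desc x w

{-# OPTIONS --safe #-}
-- A partition P = F(T, H) is read off from the map sending each leaf to the top vertex of its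
-- component in T − H. The tops of the blocks are pairwise distinct and lie in H ∪ {ρ}, so
-- |H| ≥ |P| − 1. Keeping only the edges above block tops, and when ρ tops no block also dropping
-- the topmost remaining edge (its lower component merges with the leafless component of ρ),
-- leaves exactly |P| − 1 edges. The lca of a block lies in the component of the block, so the lcas
-- are pairwise distinct too, and the lca edges number |P| − 1 or |P| according to whether some lca
-- is ρ; in a phylogenetic tree ρ is the only vertex with every leaf below it.
module Submission where

open import Defs
open import Data.Nat using (ℕ; zero; suc; _+_; _*_; _≤_; _∸_)
open import Data.Nat.Properties using (≤-trans; ≤-reflexive; m∸n≤m; 1+n≢n; +-comm; +-suc; ≤-total; m∸n+n≡m; m≤m*n; n<1+n; ≤-pred; m≤n⇒∃[o]m+o≡n; n≤1+n)
open import Data.Fin using (Fin; zero; suc; toℕ; punchIn; punchOut)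
open import Data.Fin.Properties using (suc-injective; 0≢1+n; _≟_; any?; pigeonhole; toℕ<n; punchIn-injective; punchInᵢ≢i; punchIn-punchOut)
open import Data.Fin.Subset using (Subset; _∈_; _∉_; _⊆_; _─_; _-_; ∣_∣; ⁅_⁆; inside; outside; Empty)
open import Data.Fin.Subset.Properties using (p⊆q⇒∣p∣≤∣q∣; _∈?_; p─⊥≡p; x∈p∧x≢y⇒x∈p-y; p─q⊆p; x∈⁅x⁆; Empty-unique; ∣⊥∣≡0)
open import Data.Product using (∃-syntax; _×_; _,_; proj₁; proj₂)
open import Data.Sum using (_⊎_; inj₁; inj₂; [_,_]; map₂)
open import Data.Empty using (⊥-elim)
open import Data.Vec using (_∷_; here; there; tabulate)
open import Data.Vec.Properties using (lookup∘tabulate; []=⇒lookup; lookup⇒[]=)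
open import Function using (_∘_; id; case_of_)
open import Function.Bundles using (_⇔_; mk⇔; Equivalence)
open import Function.Definitions using (Injective)
open import Relation.Binary.PropositionalEquality using (_≡_; _≢_; refl; sym; trans; cong; subst; module ≡-Reasoning)
open import Relation.Nullary using (¬_; Dec; yes; no; does; contradiction)
open import Relation.Nullary.Decidable using (dec-true; ¬?; _×-dec_; _⊎-dec_)
open import Relation.Unary using (Decidable)

open Equivalence using (to; from)

subsetOf : ∀ {n} {P : Fin n → Set} → Decidable P → Subset n
subsetOf P? = tabulate (λ v → does (P? v))

∈-subsetOf : ∀ {n} {P : Fin n → Set} (P? : Decidable P) {v} → v ∈ subsetOf P? ⇔ P v
∈-subsetOf {P = P} P? {v} = mk⇔ sound (λ p → lookup⇒[]= v _ (trans (lookup∘tabulate _ v) (dec-true (P? v) p)))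
  where
  sound : v ∈ subsetOf P? → P v
  sound v∈ with P? v | trans (sym (lookup∘tabulate _ v)) ([]=⇒lookup v∈)
  ... | yes p | _ = p

x∈p─q⇒x∉q : ∀ {n} (p q : Subset n) {x} → x ∈ p ─ q → x ∉ q
x∈p─q⇒x∉q (_ ∷ p) (inside ∷ q)  (there x∈p─q) (there x∈q) = x∈p─q⇒x∉q p q x∈p─q x∈q
x∈p─q⇒x∉q (_ ∷ p) (outside ∷ q) (there x∈p─q) (there x∈q) = x∈p─q⇒x∉q p q x∈p─q x∈q

x∈p-y⇒x≢y : ∀ {n} {p : Subset n} {x y} → x ∈ p - y → x ≢ y
x∈p-y⇒x≢y {p = p} {y = y} x∈p-y refl = x∈p─q⇒x∉q p ⁅ y ⁆ x∈p-y (x∈⁅x⁆ y)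

x∈p⇒∣p∣≡1+∣p-x∣ : ∀ {n} {p : Subset n} {x} → x ∈ p → ∣ p ∣ ≡ suc ∣ p - x ∣
x∈p⇒∣p∣≡1+∣p-x∣ {p = inside ∷ p}  here        = cong (suc ∘ ∣_∣) (sym (p─⊥≡p p))
x∈p⇒∣p∣≡1+∣p-x∣ {p = inside ∷ p}  (there x∈p) = cong suc (x∈p⇒∣p∣≡1+∣p-x∣ x∈p)
x∈p⇒∣p∣≡1+∣p-x∣ {p = outside ∷ p} (there x∈p) = x∈p⇒∣p∣≡1+∣p-x∣ x∈p

module _ {m n : ℕ} (f : Fin m → Fin n) where

  IsImage : Subset n → Set
  IsImage S = ∀ v → v ∈ S ⇔ (∃[ i ] f i ≡ v)

  IsImageWithout : Fin n → Subset n → Set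
  IsImageWithout r S = ∀ v → v ∈ S ⇔ (v ≢ r × ∃[ i ] f i ≡ v)

∣image∣≡m : ∀ {m n} {f : Fin m → Fin n} {S} → Injective _≡_ _≡_ f → IsImage f S → ∣ S ∣ ≡ m
∣image∣≡m {zero} {n} {f} {S} _ img = trans (cong ∣_∣ (Empty-unique empty)) (∣⊥∣≡0 n)
  where
  empty : Empty S
  empty (v , v∈S) with to (img v) v∈S
  ... | () , _
∣image∣≡m {suc m} {f = f} {S} inj img =
  trans (x∈p⇒∣p∣≡1+∣p-x∣ f₀∈S) (cong suc (∣image∣≡m (suc-injective ∘ inj) img′))
  where
  f₀∈S : f zero ∈ S
  f₀∈S = from (img (f zero)) (zero , refl)
  img′ : IsImage (f ∘ suc) (S - f zero)
  img′ v = mk⇔ later (λ (i , e) → x∈p∧x≢y⇒x∈p-y (from (img v) (suc i , e)) λ v≡f₀ → 0≢1+n (sym (inj (trans e v≡f₀))))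
    where
    later : v ∈ S - f zero → ∃[ i ] f (suc i) ≡ v
    later v∈ with to (img v) (p─q⊆p S ⁅ f zero ⁆ v∈)
    ... | zero  , e = contradiction (sym e) (x∈p-y⇒x≢y v∈)
    ... | suc i , e = i , e

∣image∖∣≡m : ∀ {m n} {f : Fin m → Fin n} {r S} → Injective _≡_ _≡_ f → IsImageWithout f r S →
  (∀ i → f i ≢ r) → ∣ S ∣ ≡ m
∣image∖∣≡m f-inj S-img r∉f = ∣image∣≡m f-inj λ v →
  mk⇔ (proj₂ ∘ to (S-img v)) (λ (i , e) → from (S-img v) ((λ v≡r → r∉f i (trans e v≡r)) , i , e))

∣image∖∣≡m∸1 : ∀ {m n} {f : Fin m → Fin n} {r S} → Injective _≡_ _≡_ f → IsImageWithout f r S →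
  ∀ {i₀} → f i₀ ≡ r → ∣ S ∣ ≡ m ∸ 1
∣image∖∣≡m∸1 {suc m′} {f = f} {r} {S} f-inj S-img {i₀} fi₀≡r = ∣image∣≡m (punchIn-injective i₀ _ _ ∘ f-inj) img
  where
  img : IsImage (f ∘ punchIn i₀) S
  img v = mk⇔ skip (λ (j , e) → from (S-img v)
    ((λ v≡r → punchInᵢ≢i i₀ j (f-inj (trans e (trans v≡r (sym fi₀≡r))))) , punchIn i₀ j , e))
    where
    skip : v ∈ S → ∃[ j ] f (punchIn i₀ j) ≡ v
    skip v∈S with to (S-img v) v∈S
    ... | v≢r , i , e with i₀ ≟ i
    ... | yes refl = contradiction (trans (sym e) fi₀≡r) v≢r
    ... | no i₀≢i  = punchOut i₀≢i , trans (cong f (punchIn-punchOut i₀≢i)) e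

iter-+ : ∀ {A : Set} (f : A → A) i j a → iter f (i + j) a ≡ iter f i (iter f j a)
iter-+ f zero    j a = refl
iter-+ f (suc i) j a = cong f (iter-+ f i j a)

iter-suc : ∀ {A : Set} (f : A → A) k a → iter f (suc k) a ≡ iter f k (f a)
iter-suc f zero    a = refl
iter-suc f (suc k) a = cong f (iter-suc f k a)

iter-periodic : ∀ {A : Set} (f : A → A) p {a} → iter f p a ≡ a → ∀ r → iter f (r * p) a ≡ a
iter-periodic f p     e zero    = refl
iter-periodic f p {a} e (suc r) = trans (iter-+ f p (r * p) a) (trans (cong (iter f p) (iter-periodic f p e r)) e)

module _ {n : ℕ} (T : RootedTree n) where
  open RootedTree T

  iter-par-root : ∀ k → iter par k root ≡ root
  iter-par-root zero    = refl
  iter-par-root (suc k) = trans (cong par (iter-par-root k)) par-root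

  iter-par-absorb : ∀ {j k} v → j ≤ k → iter par j v ≡ root → iter par k v ≡ root
  iter-par-absorb {j} {k} v j≤k e = begin
    iter par k v                      ≡⟨ cong (λ i → iter par i v) (sym (m∸n+n≡m j≤k)) ⟩
    iter par (k ∸ j + j) v            ≡⟨ iter-+ par (k ∸ j) j v ⟩
    iter par (k ∸ j) (iter par j v)   ≡⟨ cong (iter par (k ∸ j)) e ⟩
    iter par (k ∸ j) root             ≡⟨ iter-par-root (k ∸ j) ⟩
    root                              ∎
    where open ≡-Reasoning

  periodic⇒root : ∀ q {v} → iter par (suc q) v ≡ v → v ≡ root
  periodic⇒root q {v} e with reach v
  ... | k , e′ = trans (sym (iter-periodic par (suc q) e k)) (iter-par-absorb v (m≤m*n k (suc q)) e′)

  -- Pigeonhole on v, par v, …, parⁿ v: two of them coincide, so the earlier one lies on a cycle.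
  iter-par-n : ∀ v → iter par n v ≡ root
  iter-par-n v with pigeonhole (n<1+n n) (λ i → iter par (toℕ i) v)
  ... | i , j , i<j , e with m≤n⇒∃[o]m+o≡n i<j
  ... | o , i+1+o≡j = iter-par-absorb v (≤-pred (toℕ<n i)) cyclic
    where
    cyclic : iter par (toℕ i) v ≡ root
    cyclic = periodic⇒root o (begin
      iter par (suc o) (iter par (toℕ i) v) ≡⟨ sym (iter-+ par (suc o) (toℕ i) v) ⟩
      iter par (suc o + toℕ i) v            ≡⟨ cong (λ k → iter par k v) (trans (cong suc (+-comm o (toℕ i))) i+1+o≡j) ⟩
      iter par (toℕ j) v                    ≡⟨ sym e ⟩
      iter par (toℕ i) v                    ∎)
      where open ≡-Reasoning

  tree-ind : {P : Fin n → Set} → (∀ v → (v ≢ root → P (par v)) → P v) → ∀ v → P v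
  tree-ind {P} step v = go (proj₁ (reach v)) v (proj₂ (reach v))
    where
    go : ∀ k v → iter par k v ≡ root → P v
    go zero    v v≡root = step v (λ v≢root → contradiction v≡root v≢root)
    go (suc k) v e      = step v (λ _ → go k (par v) (trans (sym (iter-suc par k v)) e))

  Desc-trans : ∀ {a b c} → Desc T a b → Desc T b c → Desc T a c
  Desc-trans {a} (i , e) (j , e′) = j + i , trans (iter-+ par j i a) (trans (cong (iter par j) e) e′)

  Desc-antisym : ∀ {a b} → Desc T a b → Desc T b a → a ≡ b
  Desc-antisym (zero , e) _ = e
  Desc-antisym {a} {b} (suc i , e) (j , e′) = trans a≡root (sym b≡root)
    where
    a≡root : a ≡ root
    a≡root = periodic⇒root (j + i)
      (trans (cong (λ k → iter par k a) (sym (+-suc j i))) (proj₂ (Desc-trans (suc i , e) (j , e′))))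
    b≡root : b ≡ root
    b≡root = trans (sym e) (trans (cong (iter par (suc i)) a≡root) (iter-par-root (suc i)))

  Desc-along : ∀ v {i j} → i ≤ j → Desc T (iter par i v) (iter par j v)
  Desc-along v {i} {j} i≤j =
    j ∸ i , trans (sym (iter-+ par (j ∸ i) i v)) (cong (λ k → iter par k v) (m∸n+n≡m i≤j))

  Desc-total : ∀ {y a b} → Desc T y a → Desc T y b → Desc T a b ⊎ Desc T b a
  Desc-total {y} (i , refl) (j , refl) with ≤-total i j
  ... | inj₁ i≤j = inj₁ (Desc-along y i≤j)
  ... | inj₂ j≤i = inj₂ (Desc-along y j≤i)

  Desc-sibling : ∀ {c w} → par c ≡ par w → Desc T c w → c ≡ w ⊎ w ≡ root
  Desc-sibling c↑≡w↑ (zero  , e) = inj₁ e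
  Desc-sibling {c} {w} c↑≡w↑ (suc k , e) = inj₂ (periodic⇒root k (begin
    iter par (suc k) w   ≡⟨ iter-suc par k w ⟩
    iter par k (par w)   ≡⟨ cong (iter par k) (sym c↑≡w↑) ⟩
    iter par k (par c)   ≡⟨ sym (iter-suc par k c) ⟩
    iter par (suc k) c   ≡⟨ e ⟩
    w                    ∎))
    where open ≡-Reasoning

  leaf⊎child : ∀ v → IsLeaf T v ⊎ ∃[ c ] Child T c v
  leaf⊎child v with any? (λ c → ¬? (c ≟ root) ×-dec (par c ≟ v))
  ... | yes has-child = inj₂ has-child
  ... | no  no-child  = inj₁ (λ c c-child → no-child (c , c-child))

  leaf⊎chain : ∀ k v → (∃[ y ] (IsLeaf T y × Desc T y v)) ⊎ (∃[ d ] iter par k d ≡ v)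
  leaf⊎chain zero    v = inj₂ (v , refl)
  leaf⊎chain (suc k) v with leaf⊎chain k v
  ... | inj₁ leaf = inj₁ leaf
  ... | inj₂ (d , e) with leaf⊎child d
  ... | inj₁ d-leaf          = inj₁ (d , d-leaf , k , e)
  ... | inj₂ (c , _ , c↑≡d) = inj₂ (c , trans (iter-suc par k c) (trans (cong (iter par k) c↑≡d) e))

  leaf-below : ∀ v → v ≢ root → ∃[ y ] (IsLeaf T y × Desc T y v)
  leaf-below v v≢root with leaf⊎chain n v
  ... | inj₁ leaf    = leaf
  ... | inj₂ (d , e) = contradiction (trans (sym e) (iter-par-n d)) v≢root

  -- A vertex w ≠ ρ misses the leaves below a sibling of w, which exists since parent(w) has ≥ 2 children.
  clusterIsX⇒root : Phylogenetic T → ∀ w → ClusterIsX T w → w ≡ root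
  clusterIsX⇒root phyl w all↝w with w ≟ root
  ... | yes w≡root = w≡root
  ... | no  w≢root with sibling
    where
    sibling : ∃[ c ] (c ≢ root × par c ≡ par w × c ≢ w)
    sibling with phyl (par w) (λ leaf → leaf w (w≢root , refl))
    ... | u , u′ , (u≢root , u↑) , (u′≢root , u′↑) , u≢u′ with u ≟ w
    ... | yes refl = u′ , u′≢root , u′↑ , λ u′≡u → u≢u′ (sym u′≡u)
    ... | no  u≢w  = u , u≢root , u↑ , u≢w
  ... | c , c≢root , c↑≡w↑ , c≢w with leaf-below c c≢root
  ... | y , y-leaf , y↝c with Desc-total y↝c (all↝w y y-leaf)
  ... | inj₁ c↝w = ⊥-elim ([ c≢w , w≢root ] (Desc-sibling c↑≡w↑ c↝w))
  ... | inj₂ w↝c = ⊥-elim ([ c≢w ∘ sym , c≢root ] (Desc-sibling (sym c↑≡w↑) w↝c))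

  conn-trans : ∀ {H a b c} → Conn T H a b → Conn T H b c → Conn T H a c
  conn-trans here           q = q
  conn-trans (up   ne nm p) q = up   ne nm (conn-trans p q)
  conn-trans (down ne nm p) q = down ne nm (conn-trans p q)

  conn-sym : ∀ {H a b} → Conn T H a b → Conn T H b a
  conn-sym here           = here
  conn-sym (up   ne nm p) = conn-trans (conn-sym p) (down ne nm here)
  conn-sym (down ne nm p) = conn-trans (conn-sym p) (up   ne nm here)

  module _ (H : Subset n) where

    -- The vertices at which a component of T − H is rooted: ρ and the child endpoints of edges in H.
    Boundary : Fin n → Set
    Boundary v = v ≡ root ⊎ v ∈ H

    boundary? : ∀ v → Dec (Boundary v)
    boundary? v = (v ≟ root) ⊎-dec (v ∈? H)

    topWithin : ℕ → Fin n → Fin n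
    topWithin zero    v = v
    topWithin (suc k) v with boundary? v
    ... | yes _ = v
    ... | no  _ = topWithin k (par v)

    topWithin-suc : ∀ k v → iter par k v ≡ root → topWithin (suc k) v ≡ topWithin k v
    topWithin-suc zero v refl with boundary? root
    ... | yes _  = refl
    ... | no  ¬b = contradiction (inj₁ refl) ¬b
    topWithin-suc (suc k) v e with boundary? v
    ... | yes _ = refl
    ... | no  _ = topWithin-suc k (par v) (trans (sym (iter-suc par k v)) e)

    -- The fuel suc n suffices: by iter-par-n every vertex reaches ρ within n steps.
    top : Fin n → Fin n
    top = topWithin (suc n)

    top-boundary : ∀ {v} → Boundary v → top v ≡ v
    top-boundary {v} b with boundary? v
    ... | yes _  = refl
    ... | no  ¬b = contradiction b ¬b

    top-par : ∀ {v} → ¬ Boundary v → top v ≡ top (par v)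
    top-par {v} ¬b with boundary? v
    ... | yes b = contradiction b ¬b
    ... | no  _ = sym (topWithin-suc n (par v)
                    (trans (sym (iter-suc par n v)) (iter-par-absorb v (n≤1+n n) (iter-par-n v))))

    Boundary-top : ∀ v → Boundary (top v)
    Boundary-top = tree-ind step
      where
      step : ∀ v → (v ≢ root → Boundary (top (par v))) → Boundary (top v)
      step v ih = case boundary? v of λ where
        (yes b)  → subst Boundary (sym (top-boundary b)) b
        (no  ¬b) → subst Boundary (sym (top-par ¬b)) (ih (¬b ∘ inj₁))

    top∈H : ∀ v → top v ≢ root → top v ∈ H
    top∈H v t≢root with Boundary-top v
    ... | inj₁ t≡root = contradiction t≡root t≢root
    ... | inj₂ t∈H    = t∈H

    conn-top : ∀ v → Conn T H v (top v)
    conn-top = tree-ind step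
      where
      step : ∀ v → (v ≢ root → Conn T H (par v) (top (par v))) → Conn T H v (top v)
      step v ih = case boundary? v of λ where
        (yes b)  → subst (Conn T H v) (sym (top-boundary b)) here
        (no  ¬b) → subst (Conn T H v) (sym (top-par ¬b)) (up (¬b ∘ inj₁) (¬b ∘ inj₂) (ih (¬b ∘ inj₁)))

    top-resp-conn : ∀ {a b} → Conn T H a b → top a ≡ top b
    top-resp-conn here           = refl
    top-resp-conn (up   ne nm p) = trans (top-par [ ne , nm ]) (top-resp-conn p)
    top-resp-conn (down ne nm p) = trans (sym (top-par [ ne , nm ])) (top-resp-conn p)

    conn⇔top≡ : ∀ {a b} → Conn T H a b ⇔ top a ≡ top b
    conn⇔top≡ {a} {b} = mk⇔ top-resp-conn
      (λ e → conn-trans (conn-top a) (subst (λ t → Conn T H t b) (sym e) (conn-sym (conn-top b))))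

    top-desc : ∀ v → Desc T v (top v)
    top-desc = tree-ind step
      where
      step : ∀ v → (v ≢ root → Desc T (par v) (top (par v))) → Desc T v (top v)
      step v ih = case boundary? v of λ where
        (yes b)  → zero , sym (top-boundary b)
        (no  ¬b) → let k , e = ih (¬b ∘ inj₁)
                   in suc k , trans (iter-suc par k v) (trans e (sym (top-par ¬b)))

    top-between : ∀ {x w} → Desc T x w → Desc T w (top x) → top w ≡ top x
    top-between (k , e) = go k e
      where
      go : ∀ k {x w} → iter par k x ≡ w → Desc T w (top x) → top w ≡ top x
      go zero    refl _ = refl
      go (suc k) {x} {w} e w↝top = case boundary? x of λ where
        (yes b)  → cong top (sym (Desc-antisym (suc k , e) (subst (Desc T w) (top-boundary b) w↝top)))
        (no  ¬b) → trans (go k (trans (sym (iter-suc par k x)) e) (subst (Desc T w) (top-par ¬b) w↝top))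
                         (sym (top-par ¬b))

  Boundary-⊆ : ∀ {H H′} → H′ ⊆ H → ∀ {v} → Boundary H′ v → Boundary H v
  Boundary-⊆ H′⊆H = map₂ H′⊆H

  top-⊆ : ∀ {H H′} → H′ ⊆ H → ∀ x → Boundary H′ (top H x) → top H′ x ≡ top H x
  top-⊆ {H} {H′} H′⊆H = tree-ind step
    where
    step : ∀ x → (x ≢ root → Boundary H′ (top H (par x)) → top H′ (par x) ≡ top H (par x)) →
           Boundary H′ (top H x) → top H′ x ≡ top H x
    step x ih bd = case boundary? H x of λ where
      (yes b)  → trans (top-boundary H′ (subst (Boundary H′) (top-boundary H b) bd)) (sym (top-boundary H b))
      (no  ¬b) → trans (top-par H′ (¬b ∘ Boundary-⊆ H′⊆H))
                   (trans (ih (¬b ∘ inj₁) (subst (Boundary H′) (top-par H ¬b) bd)) (sym (top-par H ¬b)))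

  top-remove-other : ∀ {H s} x → top H x ≢ s → top (H - s) x ≡ top H x
  top-remove-other {H} {s} x t≢s =
    top-⊆ (p─q⊆p H ⁅ s ⁆) x (map₂ (λ t∈H → x∈p∧x≢y⇒x∈p-y t∈H t≢s) (Boundary-top H x))

  top-remove-below : ∀ {H s} x → top H x ≡ s → top (H - s) x ≡ top (H - s) s
  top-remove-below {H} {s} = tree-ind step
    where
    step : ∀ x → (x ≢ root → top H (par x) ≡ s → top (H - s) (par x) ≡ top (H - s) s) →
           top H x ≡ s → top (H - s) x ≡ top (H - s) s
    step x ih e = case boundary? H x of λ where
      (yes b)  → cong (top (H - s)) (trans (sym (top-boundary H b)) e)
      (no  ¬b) → trans (top-par (H - s) (¬b ∘ Boundary-⊆ (p─q⊆p H ⁅ s ⁆)))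
                       (ih (¬b ∘ inj₁) (trans (sym (top-par H ¬b)) e))

  top-remove-topmost : ∀ {H s} → s ≢ root → top H (par s) ≡ root → ∀ x → top H x ≡ s → top (H - s) x ≡ root
  top-remove-topmost {H} {s} s≢root top↑≡root x e = begin
    top (H - s) x        ≡⟨ top-remove-below x e ⟩
    top (H - s) s        ≡⟨ top-par (H - s) {s} [ s≢root , (λ s∈H-s → x∈p-y⇒x≢y s∈H-s refl) ] ⟩
    top (H - s) (par s)  ≡⟨ top-remove-other (par s) (λ t≡s → s≢root (trans (sym t≡s) top↑≡root)) ⟩
    top H (par s)        ≡⟨ top↑≡root ⟩
    root                 ∎
    where open ≡-Reasoning

  top≡root⊎topmost : ∀ H v → top H v ≡ root ⊎ ∃[ s ] (s ∈ H × top H (par s) ≡ root)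
  top≡root⊎topmost H = tree-ind step
    where
    step : ∀ v → (v ≢ root → top H (par v) ≡ root ⊎ ∃[ s ] (s ∈ H × top H (par s) ≡ root)) →
           top H v ≡ root ⊎ ∃[ s ] (s ∈ H × top H (par s) ≡ root)
    step v ih = case v ≟ root of λ where
      (yes v≡root) → inj₁ (trans (top-boundary H (inj₁ v≡root)) v≡root)
      (no  v≢root) → case ih v≢root of λ where
        (inj₂ topmost)   → inj₂ topmost
        (inj₁ top↑≡root) → case v ∈? H of λ where
          (yes v∈H) → inj₂ (v , v∈H , top↑≡root)
          (no  v∉H) → inj₁ (trans (top-par H [ v≢root , v∉H ]) top↑≡root)

  SameLeafTops : Subset n → Subset n → Set
  SameLeafTops H H′ = ∀ x y → IsLeaf T x → IsLeaf T y → (top H x ≡ top H y) ⇔ (top H′ x ≡ top H′ y)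

  PartEqF-resp : ∀ {m} {block : Fin n → Fin m} {H H′} → SameLeafTops H H′ → PartEqF T block H → PartEqF T block H′
  PartEqF-resp {H = H} {H′} same H-part x y x-leaf y-leaf =
    (λ e → from (conn⇔top≡ H′) (to (same x y x-leaf y-leaf) (to (conn⇔top≡ H) (proj₁ (H-part x y x-leaf y-leaf) e)))) ,
    (λ c → proj₂ (H-part x y x-leaf y-leaf) (from (conn⇔top≡ H) (from (same x y x-leaf y-leaf) (to (conn⇔top≡ H′) c))))

  sameLeafTops-≗ : ∀ {H H′} → (∀ x → IsLeaf T x → top H′ x ≡ top H x) → SameLeafTops H H′
  sameLeafTops-≗ same x y x-leaf y-leaf rewrite same x x-leaf | same y y-leaf = mk⇔ id id

  -- Cutting the topmost edge s merges the component of s with that of ρ, which contains no leaf.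
  module _ {H s} (s≢root : s ≢ root) (top↑≡root : top H (par s) ≡ root)
           (leaf-top≢root : ∀ x → IsLeaf T x → top H x ≢ root) where

    top-remove-topmost-separates : ∀ x y → IsLeaf T y → top H x ≡ s → top H y ≢ s → top (H - s) x ≢ top (H - s) y
    top-remove-topmost-separates x y y-leaf tx≡s ty≢s e = leaf-top≢root y y-leaf
      (trans (sym (top-remove-other y ty≢s)) (trans (sym e) (top-remove-topmost s≢root top↑≡root x tx≡s)))

    sameLeafTops-remove-topmost : SameLeafTops H (H - s)
    sameLeafTops-remove-topmost x y x-leaf y-leaf with top H x ≟ s | top H y ≟ s
    ... | yes tx≡s | yes ty≡s = mk⇔ (λ _ → trans (to-root x tx≡s) (sym (to-root y ty≡s))) (λ _ → trans tx≡s (sym ty≡s))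
      where
      to-root : ∀ x → top H x ≡ s → top (H - s) x ≡ root
      to-root = top-remove-topmost s≢root top↑≡root
    ... | yes tx≡s | no  ty≢s = mk⇔ (λ e → ⊥-elim (ty≢s (trans (sym e) tx≡s))) (⊥-elim ∘ top-remove-topmost-separates x y y-leaf tx≡s ty≢s)
    ... | no  tx≢s | yes ty≡s = mk⇔ (λ e → ⊥-elim (tx≢s (trans e ty≡s))) (⊥-elim ∘ top-remove-topmost-separates y x x-leaf ty≡s tx≢s ∘ sym)
    ... | no  tx≢s | no  ty≢s rewrite top-remove-other x tx≢s | top-remove-other y ty≢s = mk⇔ id id

module _ {n : ℕ} (T : RootedTree n) {m : ℕ} {block : Fin n → Fin m} (part : IsPartition T m block) where
  open RootedTree T

  rep : Fin m → Fin n
  rep i = proj₁ (part i)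

  rep-leaf : ∀ i → IsLeaf T (rep i)
  rep-leaf i = proj₁ (proj₂ (part i))

  rep-block : ∀ i → block (rep i) ≡ i
  rep-block i = proj₂ (proj₂ (part i))

  -- The top vertex of the component of T − H containing the representative of Aᵢ; it does not
  -- depend on the representative when P = F(T, H).
  blockTop : Subset n → Fin m → Fin n
  blockTop H i = top T H (rep i)

  blockTopEdge? : ∀ H v → Dec (v ≢ root × ∃[ i ] blockTop H i ≡ v)
  blockTopEdge? H v = ¬? (v ≟ root) ×-dec any? (λ i → blockTop H i ≟ v)

  blockTopEdges : Subset n → Subset n
  blockTopEdges H = subsetOf (blockTopEdge? H)

  blockTopEdges-image : ∀ H → IsImageWithout (blockTop H) root (blockTopEdges H)
  blockTopEdges-image H v = ∈-subsetOf (blockTopEdge? H)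

  root∉blockTopEdges : ∀ H → EdgeSet T (blockTopEdges H)
  root∉blockTopEdges H root∈ = proj₁ (to (blockTopEdges-image H root) root∈) refl

  blockTopEdges⊆ : ∀ H → blockTopEdges H ⊆ H
  blockTopEdges⊆ H {v} v∈ with to (blockTopEdges-image H v) v∈
  ... | v≢root , i , refl = top∈H T H (rep i) v≢root

  Boundary-blockTop : ∀ H i → Boundary T (blockTopEdges H) (blockTop H i)
  Boundary-blockTop H i with blockTop H i ≟ root
  ... | yes t≡root = inj₁ t≡root
  ... | no  t≢root = inj₂ (from (blockTopEdges-image H _) (t≢root , i , refl))

  module _ {H} (H-part : PartEqF T block H) where

    top-leaf : ∀ x → IsLeaf T x → top T H x ≡ blockTop H (block x)
    top-leaf x x-leaf = top-resp-conn T H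
      (proj₁ (H-part x (rep (block x)) x-leaf (rep-leaf (block x))) (sym (rep-block (block x))))

    blockTop-injective : Injective _≡_ _≡_ (blockTop H)
    blockTop-injective {i} {j} e = trans (sym (rep-block i))
      (trans (proj₂ (H-part (rep i) (rep j) (rep-leaf i) (rep-leaf j)) (from (conn⇔top≡ T H) e)) (rep-block j))

    top-blockTopEdges : ∀ x → IsLeaf T x → top T (blockTopEdges H) x ≡ top T H x
    top-blockTopEdges x x-leaf = top-⊆ T (blockTopEdges⊆ H) x
      (subst (Boundary T (blockTopEdges H)) (sym (top-leaf x x-leaf)) (Boundary-blockTop H (block x)))

    blockTopEdges-part : PartEqF T block (blockTopEdges H)
    blockTopEdges-part = PartEqF-resp T (sameLeafTops-≗ T top-blockTopEdges) H-part

    m∸1≤∣H∣ : m ∸ 1 ≤ ∣ H ∣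
    m∸1≤∣H∣ = ≤-trans m∸1≤∣blockTopEdges∣ (p⊆q⇒∣p∣≤∣q∣ (blockTopEdges⊆ H))
      where
      m∸1≤∣blockTopEdges∣ : m ∸ 1 ≤ ∣ blockTopEdges H ∣
      m∸1≤∣blockTopEdges∣ with any? (λ i → blockTop H i ≟ root)
      ... | yes (i , e) = ≤-reflexive (sym (∣image∖∣≡m∸1 blockTop-injective (blockTopEdges-image H) e))
      ... | no  root∉tops = subst (m ∸ 1 ≤_)
        (sym (∣image∖∣≡m blockTop-injective (blockTopEdges-image H) (λ i e → root∉tops (i , e)))) (m∸n≤m m 1)

    optimal-edges : Fin m → ∃[ Hs ] (EdgeSet T Hs × PartEqF T block Hs × ∣ Hs ∣ ≡ m ∸ 1)
    optimal-edges i₀ with any? (λ i → blockTop H i ≟ root)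
    ... | yes (i , e) = blockTopEdges H , root∉blockTopEdges H , blockTopEdges-part ,
                        ∣image∖∣≡m∸1 blockTop-injective (blockTopEdges-image H) e
    ... | no root∉tops with top≡root⊎topmost T (blockTopEdges H) (rep i₀)
    ...   | inj₁ e = contradiction (i₀ , trans (sym (top-blockTopEdges (rep i₀) (rep-leaf i₀))) e) root∉tops
    ...   | inj₂ (s , s∈S , top↑≡root) =
      blockTopEdges H - s , root∉blockTopEdges-s ,
      PartEqF-resp T (sameLeafTops-remove-topmost T s≢root top↑≡root leaf-top≢root) blockTopEdges-part ,
      cong (_∸ 1) (trans (sym (x∈p⇒∣p∣≡1+∣p-x∣ s∈S))
        (∣image∖∣≡m blockTop-injective (blockTopEdges-image H) (λ i e → root∉tops (i , e))))
      where
      root∉blockTopEdges-s : EdgeSet T (blockTopEdges H - s)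
      root∉blockTopEdges-s = root∉blockTopEdges H ∘ p─q⊆p (blockTopEdges H) ⁅ s ⁆
      s≢root : s ≢ root
      s≢root s≡root = root∉blockTopEdges H (subst (_∈ blockTopEdges H) s≡root s∈S)
      leaf-top≢root : ∀ x → IsLeaf T x → top T (blockTopEdges H) x ≢ root
      leaf-top≢root x x-leaf e =
        root∉tops (block x , trans (sym (top-leaf x x-leaf)) (trans (sym (top-blockTopEdges x x-leaf)) e))

    lca-top : ∀ {i w} → IsLCA T block i w → top T H w ≡ blockTop H i
    lca-top {i} {w} (below , least) = top-between T H (below (rep i) (rep-leaf i , rep-block i)) w↝top
      where
      w↝top : Desc T w (blockTop H i)
      w↝top = least (blockTop H i) λ x (x-leaf , x∈Aᵢ) →
        subst (Desc T x) (trans (top-leaf x x-leaf) (cong (blockTop H) x∈Aᵢ)) (top-desc T H x)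

    lca-injective : {l : Fin m → Fin n} → (∀ i → IsLCA T block i (l i)) → Injective _≡_ _≡_ l
    lca-injective l-lca {i} {j} e =
      blockTop-injective (trans (sym (lca-top (l-lca i))) (trans (cong (top T H) e) (lca-top (l-lca j))))

m∸1≢m : ∀ {m} → Fin m → m ∸ 1 ≢ m
m∸1≢m {suc m} _ m≡1+m = 1+n≢n (sym m≡1+m)

lemma4p6 : {n : ℕ} (T : RootedTree n) → Phylogenetic T → AtLeastTwoLeaves T →
    (m : ℕ) (block : Fin n → Fin m) → IsPartition T m block → Compatible T block →
    (∃[ Hs ] (EdgeSet T Hs × PartEqF T block Hs × ∣ Hs ∣ ≡ m ∸ 1 ×
        (∀ H' → EdgeSet T H' → PartEqF T block H' → ∣ Hs ∣ ≤ ∣ H' ∣)))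
    ×
    ((l : Fin m → Fin n) → (∀ i → IsLCA T block i (l i)) →
     (H : Subset n) →
     (∀ v → (v ∈ H) ⇔ (v ≢ RootedTree.root T × ∃[ i ] l i ≡ v)) →
     ((∣ H ∣ ≡ m ∸ 1 ⊎ ∣ H ∣ ≡ m) ×
      ((∣ H ∣ ≡ m ∸ 1) ⇔ (∃[ i ] ClusterIsX T (l i)))))
lemma4p6 {n} T phyl (x₀ , _) m block part (H₀ , _ , H₀-part)
  with optimal-edges T part H₀-part (block x₀)
... | Hs , Hs-edges , Hs-part , ∣Hs∣≡m∸1 =
  (Hs , Hs-edges , Hs-part , ∣Hs∣≡m∸1 ,
   λ H′ _ H′-part → subst (_≤ ∣ H′ ∣) (sym ∣Hs∣≡m∸1) (m∸1≤∣H∣ T part H′-part)) ,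
  lca-edges
  where
  open RootedTree T
  lca-edges : (l : Fin m → Fin n) → (∀ i → IsLCA T block i (l i)) → (H : Subset n) → IsImageWithout l root H →
    (∣ H ∣ ≡ m ∸ 1 ⊎ ∣ H ∣ ≡ m) × ((∣ H ∣ ≡ m ∸ 1) ⇔ (∃[ i ] ClusterIsX T (l i)))
  lca-edges l l-lca H H-image with any? (λ i → l i ≟ root)
  ... | yes (i , lᵢ≡root) = inj₁ ∣H∣≡m∸1 , mk⇔ (λ _ → i , λ x _ → subst (Desc T x) (sym lᵢ≡root) (reach x)) (λ _ → ∣H∣≡m∸1)
    where
    ∣H∣≡m∸1 : ∣ H ∣ ≡ m ∸ 1
    ∣H∣≡m∸1 = ∣image∖∣≡m∸1 (lca-injective T part H₀-part l-lca) H-image lᵢ≡root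
  ... | no root∉l = inj₂ ∣H∣≡m ,
    mk⇔ (λ e → contradiction (trans (sym e) ∣H∣≡m) (m∸1≢m (block x₀)))
        (λ (i , Xᵢ) → contradiction (i , clusterIsX⇒root T phyl (l i) Xᵢ) root∉l)
    where
    ∣H∣≡m : ∣ H ∣ ≡ m
    ∣H∣≡m = ∣image∖∣≡m (lca-injective T part H₀-part l-lca) H-image (λ i lᵢ≡root → root∉l (i , lᵢ≡root))
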